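{- Let $G$ be a connected graph. Then $G$ is edge-critical if and only if every edge of $G$ lies on a convex $P_3$ of $G$.
   Context: All graphs are finite and simple; $d_G(u,v)$ denotes the distance in $G$ (taken to be $\infty$ if no path exists). An edge $xy$ of $G$ is (distance) critical if there exist vertices $u,v\in V(G)$ with $\{u,v\}\neq\{x,y\}$ such that $d_{G-xy}(u,v)>d_G(u,v)$, where $G-xy$ is $G$ with the edge $xy$ removed. $G$ is edge-critical if every edge of $G$ is critical. A subgraph $H$ of $G$ is convex if for any two vertices $u,v$ of $H$, all shortest $u,v$-paths of $G$ lie in $H$. A convex $P_3$ is a path $uvw$ on three vertices forming a convex subgraph (equivalently, $uw\notin E(G)$ and $v$ is the only common neighbor of $u$ and $w$). -}

module Defs where

open import Data.Nat using (ℕ; zero; suc; _<_)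
open import Data.Fin using (Fin)
open import Data.Fin.Properties using (_≟_)
open import Data.Bool using (Bool; true; false; T; _∧_; _∨_; not)
open import Data.Product using (Σ; ∃; ∃-syntax; _×_; _,_)
open import Data.Sum using (_⊎_)
open import Relation.Nullary using (¬_; Dec; yes; no)
open import Relation.Nullary.Decidable using (⌊_⌋)
open import Relation.Binary.PropositionalEquality using (_≡_)

record Graph (n : ℕ) : Set where
  field
    adj     : Fin n → Fin n → Bool
    symm    : ∀ x y → adj x y ≡ adj y x
    irrefl  : ∀ x → adj x x ≡ false

open Graph public

AdjRel : ℕ → Set
AdjRel n = Fin n → Fin n → Bool

Adj : ∀ {n} → Graph n → Fin n → Fin n → Set
Adj G x y = T (adj G x y)

SamePair : ∀ {n} → Fin n → Fin n → Fin n → Fin n → Set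
SamePair a b x y = (a ≡ x × b ≡ y) ⊎ (a ≡ y × b ≡ x)

samePair? : ∀ {n} (a b x y : Fin n) → Bool
samePair? a b x y = (⌊ a ≟ x ⌋ ∧ ⌊ b ≟ y ⌋) ∨ (⌊ a ≟ y ⌋ ∧ ⌊ b ≟ x ⌋)

removeEdge : ∀ {n} → Graph n → Fin n → Fin n → AdjRel n
removeEdge G x y a b = adj G a b ∧ not (samePair? a b x y)

data Walk {n : ℕ} (E : AdjRel n) : Fin n → Fin n → ℕ → Set where
  nil  : ∀ {a} → Walk E a a zero
  cons : ∀ {a c b k} → T (E a c) → Walk E c b k → Walk E a b (suc k)

-- d_E(a,b) = k  (finite distance); d_E(a,b) = ∞ iff no k satisfies this
Dist : ∀ {n} → AdjRel n → Fin n → Fin n → ℕ → Set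
Dist E a b k = Walk E a b k × (∀ m → m < k → ¬ Walk E a b m)

-- d_{E'}(u,v) > d_E(u,v)  (with ∞ > every finite number, and ∞ ≯ ∞)
DistIncreases : ∀ {n} → AdjRel n → AdjRel n → Fin n → Fin n → Set
DistIncreases E E' u v =
  ∃[ k ] (Dist E u v k × (∀ m → Dist E' u v m → k < m))

CriticalEdge : ∀ {n} → Graph n → Fin n → Fin n → Set
CriticalEdge G x y =
  Adj G x y ×
  ∃[ u ] ∃[ v ] (¬ SamePair u v x y × DistIncreases (adj G) (removeEdge G x y) u v)

EdgeCritical : ∀ {n} → Graph n → Set
EdgeCritical G = ∀ x y → Adj G x y → CriticalEdge G x y

Connected : ∀ {n} → Graph n → Set
Connected G = ∀ u v → ∃[ k ] Walk (adj G) u v k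

module _ {n : ℕ} (u v w : Fin n) where
  InP3V : Fin n → Set
  InP3V a = a ≡ u ⊎ a ≡ v ⊎ a ≡ w

  InP3E : Fin n → Fin n → Set
  InP3E a b = SamePair a b u v ⊎ SamePair a b v w

WalkInP3 : ∀ {n} {E : AdjRel n} (u v w : Fin n) {a b k} → Walk E a b k → Set
WalkInP3 u v w {a} nil = InP3V u v w a
WalkInP3 u v w {a} (cons {c = c} _ p) = InP3V u v w a × InP3E u v w a c × WalkInP3 u v w p

-- H = uvw is a path P3 in G which is a convex subgraph: every shortest
-- a,b-walk (= shortest a,b-path) of G between vertices of H lies in H.
ConvexP3 : ∀ {n} → Graph n → Fin n → Fin n → Fin n → Set
ConvexP3 G u v w =
  ¬ u ≡ v × ¬ v ≡ w × ¬ u ≡ w × Adj G u v × Adj G v w ×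
  (∀ a b → InP3V u v w a → InP3V u v w b →
     ∀ k (p : Walk (adj G) a b k) → Dist (adj G) a b k → WalkInP3 u v w p)

OnConvexP3 : ∀ {n} → Graph n → Fin n → Fin n → Set
OnConvexP3 G x y =
  ∃[ u ] ∃[ v ] ∃[ w ] (ConvexP3 G u v w × (SamePair x y u v ⊎ SamePair x y v w))

{-# OPTIONS --safe #-}

-- A convex P3 abc is exactly a path whose ends a, c are non-adjacent and have b as their
-- only common neighbour. If xy lies on it, deleting xy kills every a,c-walk of length 2,
-- so d(a,c) = 2 increases. Conversely, if deleting xy increases d(u,v), then every
-- shortest u,v-walk uses xy, and since {u,v} ≠ {x,y} it contains three consecutive
-- vertices a b c with b ∈ {x,y}. As a subwalk of a geodesic, abc is a geodesic, so
-- d(a,c) = 2; a second common neighbour z of a and c would give a u,v-walk of the same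
-- length through a z c avoiding xy, because the parts of the geodesic before a and after c
-- never reach b.

module Submission where

open import Defs
open import Data.Bool using (true; false; T; not; _∧_)
open import Data.Bool.Properties using (T-∧; T-∨)
open import Data.Empty using (⊥-elim)
open import Data.Fin using (Fin)
open import Data.Fin.Properties using (_≟_; any?)
open import Data.Nat using (ℕ; zero; suc; _+_; _<_; _≤_; z≤n; s≤s)
open import Data.Nat.Induction using (<-rec)
open import Data.Nat.Properties
  using ( ≤-refl; ≤-trans; <⇒≤; <⇒≱; ≮⇒≥; n<1+n; n≤1+n; +-suc; m≤m+n; m≤n+m
        ; +-monoʳ-≤; +-monoˡ-<; +-monoʳ-<; anyUpTo? )
open import Data.Product using (∃-syntax; _×_; _,_; proj₁; proj₂)
import Data.Product as Product
open import Data.Sum using (_⊎_; inj₁; inj₂; [_,_])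
import Data.Sum as Sum
open import Function using (_∘_)
open import Function.Bundles using (_⇔_; mk⇔; Equivalence)
open import Relation.Nullary using (¬_; Dec; yes; no)
open import Relation.Nullary.Decidable using (map′; ⌊_⌋; toWitness; fromWitness)
open import Relation.Nullary.Decidable.Core using (T?; _×-dec_)
open import Relation.Binary.PropositionalEquality using (_≡_; refl; sym; trans; cong; subst)

open Equivalence using (to; from)

private variable
  n i j k l : ℕ
  a b c s t u v x y : Fin n
  E E′ : AdjRel n

T-not⇔¬T : ∀ {β} → T (not β) ⇔ (¬ T β)
T-not⇔¬T {false} = mk⇔ (λ _ ()) _
T-not⇔¬T {true}  = mk⇔ (λ ()) (λ ¬t → ¬t _)

_++ʷ_ : Walk E a b i → Walk E b c j → Walk E a c (i + j)
nil      ++ʷ q = q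
cons e p ++ʷ q = cons e (p ++ʷ q)

unsnoc : Walk E a b (suc i) → ∃[ c ] (Walk E a c i × T (E c b))
unsnoc (cons e nil)        = _ , nil , e
unsnoc (cons e (cons f p)) with unsnoc (cons f p)
... | c , q , g = c , cons e q , g

walk-map : (∀ {a b} → T (E a b) → T (E′ a b)) → Walk E a b k → Walk E′ a b k
walk-map f nil        = nil
walk-map f (cons e p) = cons (f e) (walk-map f p)

walk₀⇒≡ : Walk E a b 0 → a ≡ b
walk₀⇒≡ nil = refl

walk? : (E : AdjRel n) → ∀ k a b → Dec (Walk E a b k)
walk? E zero    a b = map′ (λ { refl → nil }) walk₀⇒≡ (a ≟ b)
walk? E (suc k) a b = map′ (λ (_ , e , p) → cons e p) (λ { (cons e p) → _ , e , p })
                           (any? λ c → T? (E a c) ×-dec walk? E k c b)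

NoWalkBelow : AdjRel n → Fin n → Fin n → ℕ → Set
NoWalkBelow E a b k = ∀ m → m < k → ¬ Walk E a b m

noWalkBelow-++ˡ : Walk E b c j → NoWalkBelow E a c (i + j) → NoWalkBelow E a b i
noWalkBelow-++ˡ {j = j} q none m m<i p = none (m + j) (+-monoˡ-< j m<i) (p ++ʷ q)

noWalkBelow-++ʳ : Walk E a b i → NoWalkBelow E a c (i + j) → NoWalkBelow E b c j
noWalkBelow-++ʳ {i = i} p none m m<j q = none (i + m) (+-monoʳ-< i m<j) (p ++ʷ q)

noWalkBelow₂⇔ : NoWalkBelow E a b 2 ⇔ (¬ a ≡ b × ¬ T (E a b))
noWalkBelow₂⇔ {E = E} {a} = mk⇔
  (λ none → (λ { refl → none 0 (s≤s z≤n) nil }) , (λ e → none 1 ≤-refl (cons e nil)))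
  λ { (a≢b , a≁b) 0 _ p → a≢b (walk₀⇒≡ p)
    ; (a≢b , a≁b) 1 _ (cons e nil) → a≁b e
    ; _ (suc (suc _)) (s≤s (s≤s ())) _ }

shortest-walk : Walk E a b l → ∃[ m ] (m ≤ l × Dist E a b m)
shortest-walk {E = E} {a} {b} {l} = <-rec Shortens step l
  where
  Shortens : ℕ → Set
  Shortens l = Walk E a b l → ∃[ m ] (m ≤ l × Dist E a b m)
  step : ∀ l → (∀ {m} → m < l → Shortens m) → Shortens l
  step l rec p with anyUpTo? (λ m → walk? E m a b) l
  ... | yes (m , m<l , q) =
    let (m′ , m′≤m , d) = rec m<l q in m′ , ≤-trans m′≤m (<⇒≤ m<l) , d
  ... | no none = l , ≤-refl , p , λ m m<l q → none (m , m<l , q)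

distIncreases⇔ : DistIncreases E E′ u v ⇔ (∃[ k ] (Dist E u v k × NoWalkBelow E′ u v (suc k)))
distIncreases⇔ = mk⇔
  (λ (k , d , longer) → k , d , λ { m (s≤s m≤k) p →
     let (m′ , m′≤m , d′) = shortest-walk p in <⇒≱ (longer m′ d′) (≤-trans m′≤m m≤k) })
  (λ (k , d , none) → k , d , λ m (p , _) → ≮⇒≥ (λ m<1+k → none m m<1+k p))

samePair⇔ : T (samePair? a b x y) ⇔ SamePair a b x y
samePair⇔ {a = a} {b} {x} {y} =
  mk⇔ (Sum.map (to (both (a ≟ x) (b ≟ y))) (to (both (a ≟ y) (b ≟ x))) ∘ to T-∨)
      (from T-∨ ∘ Sum.map (from (both (a ≟ x) (b ≟ y))) (from (both (a ≟ y) (b ≟ x))))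
  where
  both : ∀ {P Q : Set} (p? : Dec P) (q? : Dec Q) → T (⌊ p? ⌋ ∧ ⌊ q? ⌋) ⇔ (P × Q)
  both p? q? = mk⇔
    (Product.map (toWitness {a? = p?}) (toWitness {a? = q?}) ∘ to T-∧)
    (from T-∧ ∘ Product.map (fromWitness {a? = p?}) (fromWitness {a? = q?}))

samePair-sym : SamePair a b x y → SamePair x y a b
samePair-sym (inj₁ (refl , refl)) = inj₁ (refl , refl)
samePair-sym (inj₂ (refl , refl)) = inj₂ (refl , refl)

EndOf : Fin n → Fin n → Fin n → Set
EndOf b x y = b ≡ x ⊎ b ≡ y

endOf-resp : SamePair s t x y → EndOf b x y → EndOf b s t
endOf-resp (inj₁ (refl , refl)) = Sum.swap ∘ Sum.swap
endOf-resp (inj₂ (refl , refl)) = Sum.swap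

middle-endOf : SamePair x y a b ⊎ SamePair x y b c → EndOf b x y
middle-endOf = [ (λ xy≈ab → endOf-resp xy≈ab (inj₂ refl))
                , (λ xy≈bc → endOf-resp xy≈bc (inj₁ refl)) ]

¬samePair-avoiding : EndOf b x y → ¬ s ≡ b → ¬ t ≡ b → ¬ SamePair s t x y
¬samePair-avoiding b∈xy s≢b t≢b st≈xy = [ s≢b ∘ sym , t≢b ∘ sym ] (endOf-resp st≈xy b∈xy)

pattern is-a = inj₁ refl
pattern is-b = inj₂ (inj₁ refl)
pattern is-c = inj₂ (inj₂ refl)
pattern same    = inj₁ (refl , refl)
pattern swapped = inj₂ (refl , refl)

module _ (G : Graph n) where

  adj⇒≢ : Adj G a b → ¬ a ≡ b
  adj⇒≢ {a} e refl = subst T (irrefl G a) e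

  adj-sym : Adj G a b → Adj G b a
  adj-sym {a} {b} = subst T (symm G a b)

  removeEdge⇔ : T (removeEdge G x y a b) ⇔ (Adj G a b × ¬ SamePair a b x y)
  removeEdge⇔ = mk⇔
    (Product.map₂ (λ ¬xy → to T-not⇔¬T ¬xy ∘ from samePair⇔) ∘ to T-∧)
    (from T-∧ ∘ Product.map₂ (λ ¬xy → from T-not⇔¬T (¬xy ∘ to samePair⇔)))

  record SoleCommonNeighbour (a b c : Fin n) : Set where
    field
      a≢c    : ¬ a ≡ c
      a≁c    : ¬ Adj G a c
      a∼b    : Adj G a b
      b∼c    : Adj G b c
      unique : ∀ z → Adj G a z → Adj G z c → z ≡ b

  distance-two : SoleCommonNeighbour a b c → Dist (adj G) a c 2
  distance-two scn = cons a∼b (cons b∼c nil) , from noWalkBelow₂⇔ (a≢c , a≁c)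
    where open SoleCommonNeighbour scn

  module _ (scn : SoleCommonNeighbour a b c) where
    open SoleCommonNeighbour scn

    within-two : InP3V a b c s → InP3V a b c t → ∃[ m ] (m ≤ 2 × Walk (adj G) s t m)
    within-two is-a is-a = 0 , z≤n , nil
    within-two is-a is-b = 1 , s≤s z≤n , cons a∼b nil
    within-two is-a is-c = 2 , ≤-refl , cons a∼b (cons b∼c nil)
    within-two is-b is-a = 1 , s≤s z≤n , cons (adj-sym a∼b) nil
    within-two is-b is-b = 0 , z≤n , nil
    within-two is-b is-c = 1 , s≤s z≤n , cons b∼c nil
    within-two is-c is-a = 2 , ≤-refl , cons (adj-sym b∼c) (cons (adj-sym a∼b) nil)
    within-two is-c is-b = 1 , s≤s z≤n , cons (adj-sym b∼c) nil
    within-two is-c is-c = 0 , z≤n , nil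

    edge-inP3 : InP3V a b c s → InP3V a b c t → Adj G s t → InP3E a b c s t
    edge-inP3 is-a is-a e = ⊥-elim (adj⇒≢ e refl)
    edge-inP3 is-a is-b e = inj₁ same
    edge-inP3 is-a is-c e = ⊥-elim (a≁c e)
    edge-inP3 is-b is-a e = inj₁ swapped
    edge-inP3 is-b is-b e = ⊥-elim (adj⇒≢ e refl)
    edge-inP3 is-b is-c e = inj₂ same
    edge-inP3 is-c is-a e = ⊥-elim (a≁c (adj-sym e))
    edge-inP3 is-c is-b e = inj₂ swapped
    edge-inP3 is-c is-c e = ⊥-elim (adj⇒≢ e refl)

    far-pair-inP3 : InP3V a b c s → InP3V a b c t → NoWalkBelow (adj G) s t 2 →
                    (s ≡ a × t ≡ c) ⊎ (s ≡ c × t ≡ a)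
    far-pair-inP3 is-a is-a none = ⊥-elim (none 0 (s≤s z≤n) nil)
    far-pair-inP3 is-a is-b none = ⊥-elim (none 1 ≤-refl (cons a∼b nil))
    far-pair-inP3 is-a is-c _    = same
    far-pair-inP3 is-b is-a none = ⊥-elim (none 1 ≤-refl (cons (adj-sym a∼b) nil))
    far-pair-inP3 is-b is-b none = ⊥-elim (none 0 (s≤s z≤n) nil)
    far-pair-inP3 is-b is-c none = ⊥-elim (none 1 ≤-refl (cons b∼c nil))
    far-pair-inP3 is-c is-a _    = swapped
    far-pair-inP3 is-c is-b none = ⊥-elim (none 1 ≤-refl (cons (adj-sym b∼c) nil))
    far-pair-inP3 is-c is-c none = ⊥-elim (none 0 (s≤s z≤n) nil)

    geodesic-inP3 : InP3V a b c s → InP3V a b c t → (p : Walk (adj G) s t k) →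
                    NoWalkBelow (adj G) s t k → WalkInP3 a b c p
    geodesic-inP3 s∈ t∈ nil _ = s∈
    geodesic-inP3 s∈ t∈ (cons e nil) _ = s∈ , edge-inP3 s∈ t∈ e , t∈
    geodesic-inP3 s∈ t∈ (cons {c = z} e (cons f nil)) none with far-pair-inP3 s∈ t∈ none
    ... | same    rewrite unique z e f = s∈ , inj₁ same , is-b , inj₂ same , t∈
    ... | swapped rewrite unique z (adj-sym f) (adj-sym e) =
      s∈ , inj₂ swapped , is-b , inj₁ swapped , t∈
    geodesic-inP3 s∈ t∈ (cons _ (cons _ (cons _ _))) none =
      let (m , m≤2 , p) = within-two s∈ t∈
      in ⊥-elim (none m (s≤s (≤-trans m≤2 (s≤s (s≤s z≤n)))) p)

  soleCommonNeighbour⇒convexP3 : SoleCommonNeighbour a b c → ConvexP3 G a b c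
  soleCommonNeighbour⇒convexP3 scn =
    adj⇒≢ a∼b , adj⇒≢ b∼c , a≢c , a∼b , b∼c ,
    λ _ _ s∈ t∈ _ p (_ , none) → geodesic-inP3 scn s∈ t∈ p none
    where open SoleCommonNeighbour scn

  convexP3⇒soleCommonNeighbour : ConvexP3 G a b c → SoleCommonNeighbour a b c
  convexP3⇒soleCommonNeighbour {a} {b} {c} (a≢b , b≢c , a≢c , a∼b , b∼c , convex) =
    record { a≢c = a≢c ; a≁c = a≁c ; a∼b = a∼b ; b∼c = b∼c ; unique = unique }
    where
    a≁c : ¬ Adj G a c
    a≁c e with convex a c is-a is-c 1 (cons e nil)
                      (cons e nil , λ { 0 _ p → a≢c (walk₀⇒≡ p) ; (suc _) (s≤s ()) _ })
    ... | _ , inj₁ (inj₁ (_ , c≡b)) , _ = b≢c (sym c≡b)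
    ... | _ , inj₁ (inj₂ (a≡b , _)) , _ = a≢b a≡b
    ... | _ , inj₂ (inj₁ (a≡b , _)) , _ = a≢b a≡b
    ... | _ , inj₂ (inj₂ (a≡c , _)) , _ = a≢c a≡c
    unique : ∀ z → Adj G a z → Adj G z c → z ≡ b
    unique z e f with convex a c is-a is-c 2 (cons e (cons f nil))
                            (cons e (cons f nil) , from noWalkBelow₂⇔ (a≢c , a≁c))
    ... | _ , inj₁ (inj₁ (_ , z≡b)) , _ = z≡b
    ... | _ , inj₁ (inj₂ (a≡b , _)) , _ = ⊥-elim (a≢b a≡b)
    ... | _ , inj₂ (inj₁ (a≡b , _)) , _ = ⊥-elim (a≢b a≡b)
    ... | _ , inj₂ (inj₂ (a≡c , _)) , _ = ⊥-elim (a≢c a≡c)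

  module _ {x y : Fin n} where

    private
      G-xy : AdjRel n
      G-xy = removeEdge G x y

    record EdgeSplit (a c : Fin n) (k : ℕ) : Set where
      constructor split
      field
        {s′ t′} : Fin n
        {i′ j′} : ℕ
        st≈xy   : SamePair s′ t′ x y
        s∼t     : Adj G s′ t′
        before  : Walk (adj G) a s′ i′
        after   : Walk (adj G) t′ c j′
        length  : i′ + suc j′ ≡ k

    lift-or-split : Walk (adj G) a c k → Walk G-xy a c k ⊎ EdgeSplit a c k
    lift-or-split nil = inj₁ nil
    lift-or-split (cons {a} {d} e p) with T? (samePair? a d x y)
    ... | yes ad≈xy = inj₂ (split (to samePair⇔ ad≈xy) e nil p refl)
    ... | no ¬ad≈xy with lift-or-split p
    ...   | inj₁ p′ = inj₁ (cons (from removeEdge⇔ (e , ¬ad≈xy ∘ from samePair⇔)) p′)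
    ...   | inj₂ (split st≈xy s∼t q r len) = inj₂ (split st≈xy s∼t (cons e q) r (cong suc len))

    lift-avoidingˡ : EndOf b x y → NoWalkBelow (adj G) a b (suc k) →
                     Walk (adj G) a c k → Walk G-xy a c k
    lift-avoidingˡ b∈xy none p with lift-or-split p
    ... | inj₁ p′ = p′
    ... | inj₂ (split {i′ = i} st≈xy s∼t q _ refl) with endOf-resp st≈xy b∈xy
    ...   | inj₁ refl = ⊥-elim (none i (s≤s (m≤m+n i _)) q)
    ...   | inj₂ refl =
      ⊥-elim (none (i + 1) (s≤s (+-monoʳ-≤ i (s≤s z≤n))) (q ++ʷ cons s∼t nil))

    lift-avoidingʳ : EndOf b x y → NoWalkBelow (adj G) b c (suc k) →
                     Walk (adj G) a c k → Walk G-xy a c k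
    lift-avoidingʳ b∈xy none p with lift-or-split p
    ... | inj₁ p′ = p′
    ... | inj₂ (split {i′ = i} {j′ = j} st≈xy s∼t _ r refl) with endOf-resp st≈xy b∈xy
    ...   | inj₁ refl = ⊥-elim (none (suc j) (s≤s (m≤n+m (suc j) i)) (cons s∼t r))
    ...   | inj₂ refl = ⊥-elim (none j (s≤s (≤-trans (n≤1+n j) (m≤n+m (suc j) i))) r)

    geodesic-through⇒soleCommonNeighbour :
      SamePair x y a b ⊎ SamePair x y b c →
      Walk (adj G) u a i → Adj G a b → Adj G b c → Walk (adj G) c v j → i + suc (suc j) ≡ k →
      NoWalkBelow (adj G) u v k → NoWalkBelow G-xy u v (suc k) → SoleCommonNeighbour a b c
    geodesic-through⇒soleCommonNeighbour {a = a} {b} {c} {u} {i} {v} {j} {k}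
                                         xy∈abc q a∼b b∼c r refl none none′ =
      record { a≢c = a≢c ; a≁c = a≁c ; a∼b = a∼b ; b∼c = b∼c ; unique = unique }
      where
      b∈xy : EndOf b x y
      b∈xy = middle-endOf xy∈abc
      a≢c×a≁c : ¬ a ≡ c × ¬ Adj G a c
      a≢c×a≁c = to noWalkBelow₂⇔ (noWalkBelow-++ˡ r (noWalkBelow-++ʳ q none))
      a≢c : ¬ a ≡ c
      a≢c = proj₁ a≢c×a≁c
      a≁c : ¬ Adj G a c
      a≁c = proj₂ a≢c×a≁c
      q′ : Walk G-xy u a i
      q′ = lift-avoidingˡ b∈xy (noWalkBelow-++ˡ (cons b∼c r) none-u-v) q
        where
        none-u-v : NoWalkBelow (adj G) u v (suc i + suc j)
        none-u-v = subst (NoWalkBelow (adj G) u v) (+-suc i (suc j)) none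
      r′ : Walk G-xy c v j
      r′ = lift-avoidingʳ b∈xy (noWalkBelow-++ʳ (cons a∼b nil) (noWalkBelow-++ʳ q none)) r
      unique : ∀ z → Adj G a z → Adj G z c → z ≡ b
      unique z a∼z z∼c with z ≟ b
      ... | yes z≡b = z≡b
      ... | no z≢b = ⊥-elim (none′ k (n<1+n k) (q′ ++ʷ cons a→z (cons z→c r′)))
        where
        a→z : T (G-xy a z)
        a→z = from removeEdge⇔ (a∼z , ¬samePair-avoiding b∈xy (adj⇒≢ a∼b) z≢b)
        z→c : T (G-xy z c)
        z→c = from removeEdge⇔ (z∼c , ¬samePair-avoiding b∈xy z≢b (adj⇒≢ b∼c ∘ sym))

    critical⇒onConvexP3 : CriticalEdge G x y → OnConvexP3 G x y
    critical⇒onConvexP3 (_ , u , v , uv≉xy , increase) with to distIncreases⇔ increase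
    ... | k , (p , none) , none′ with lift-or-split p
    ... | inj₁ p′ = ⊥-elim (none′ k (n<1+n k) p′)
    ... | inj₂ (split st≈xy s∼t q (cons t∼c r) len) =
      let xy∈stc = inj₁ (samePair-sym st≈xy) in
      _ , _ , _ , soleCommonNeighbour⇒convexP3
        (geodesic-through⇒soleCommonNeighbour xy∈stc q s∼t t∼c r len none none′) , xy∈stc
    ... | inj₂ (split st≈xy s∼t nil nil _) = ⊥-elim (uv≉xy st≈xy)
    ... | inj₂ (split st≈xy s∼t q@(cons _ _) nil len) with unsnoc q
    ...   | _ , q₀ , a∼s =
      let xy∈ast = inj₂ (samePair-sym st≈xy) in
      _ , _ , _ , soleCommonNeighbour⇒convexP3
        (geodesic-through⇒soleCommonNeighbour xy∈ast q₀ a∼s s∼t nil (trans (+-suc _ 1) len)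
                                              none none′) , xy∈ast

  onConvexP3⇒critical : Adj G x y → OnConvexP3 G x y → CriticalEdge G x y
  onConvexP3⇒critical {x} {y} x∼y (a , b , c , convex , xy∈abc) =
    x∼y , a , c , ac≉xy , from distIncreases⇔ (2 , distance-two scn , none′)
    where
    scn : SoleCommonNeighbour a b c
    scn = convexP3⇒soleCommonNeighbour convex
    open SoleCommonNeighbour scn
    ac≉xy : ¬ SamePair a c x y
    ac≉xy = ¬samePair-avoiding (middle-endOf xy∈abc) (adj⇒≢ a∼b) (adj⇒≢ b∼c ∘ sym)
    lower : Walk (removeEdge G x y) a c k → Walk (adj G) a c k
    lower = walk-map (proj₁ ∘ to removeEdge⇔)
    none′ : NoWalkBelow (removeEdge G x y) a c 3
    none′ 0 _ p = proj₂ (distance-two scn) 0 (s≤s z≤n) (lower p)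
    none′ 1 _ p = proj₂ (distance-two scn) 1 ≤-refl (lower p)
    none′ 2 _ (cons {c = z} e (cons f nil))
      with to removeEdge⇔ e | to removeEdge⇔ f
    ... | a∼z , az≉xy | z∼c , zc≉xy rewrite unique z a∼z z∼c =
      [ az≉xy ∘ samePair-sym , zc≉xy ∘ samePair-sym ] xy∈abc
    none′ (suc (suc (suc _))) (s≤s (s≤s (s≤s ()))) _

lemma2p1 : ∀ {n} (G : Graph n) → Connected G →
    EdgeCritical G ⇔ (∀ x y → Adj G x y → OnConvexP3 G x y)
lemma2p1 G _ = mk⇔
  (λ critical x y x∼y → critical⇒onConvexP3 G (critical x y x∼y))
  (λ onP3 x y x∼y → onConvexP3⇒critical G x∼y (onP3 x y x∼y))
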